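{- Let $G$ and $H$ be finite simple graphs. Then $(G\square H)_\delta=G_\delta\square H_\delta$ if and only if $G=K_1$ or $H=K_1$.
   Context: All graphs are finite and simple; $K_1$ is the graph with a single vertex; $d_G(x)$ denotes the degree of $x$ in $G$. The $\delta$-complement $G_\delta$ of a graph $G$ is the graph on $V(G)$ in which distinct $u,v$ are adjacent iff either ($d_G(u)=d_G(v)$ and $uv\notin E(G)$) or ($d_G(u)\neq d_G(v)$ and $uv\in E(G)$). The Cartesian product $G\square H$ has vertex set $V(G)\times V(H)$, with $(x,y)$ adjacent to $(x',y')$ iff either $x=x'$ and $yy'\in E(H)$, or $y=y'$ and $xx'\in E(G)$. -}

module Defs where

open import Data.Nat using (ℕ; zero; suc; _+_; _*_; _≡ᵇ_)

open import Data.Bool using (Bool; true; false; if_then_else_; _∧_; _∨_; not)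
open import Data.Fin using (Fin; zero; suc; remQuot)
open import Data.Fin.Properties using (_≟_)
open import Data.Product using (_×_; _,_; proj₁; proj₂)
open import Relation.Nullary.Decidable using (⌊_⌋)
open import Relation.Binary.PropositionalEquality using (_≡_)

record Graph (n : ℕ) : Set where
  constructor mkGraph
  field adj : Fin n → Fin n → Bool
open Graph public

record IsSimple {n : ℕ} (G : Graph n) : Set where
  field
    symmetric   : ∀ u v → adj G u v ≡ adj G v u
    irreflexive : ∀ u → adj G u u ≡ false

countTrue : ∀ {n} → (Fin n → Bool) → ℕ
countTrue {zero}  f = 0
countTrue {suc n} f = (if f zero then 1 else 0) + countTrue (λ i → f (suc i))

degree : ∀ {n} → Graph n → Fin n → ℕ
degree G u = countTrue (adj G u)

δ-complement : ∀ {n} → Graph n → Graph n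
δ-complement G = mkGraph λ u v →
  if ⌊ u ≟ v ⌋ then false
  else (if degree G u ≡ᵇ degree G v then not (adj G u v) else adj G u v)

-- Cartesian product, vertex (x , y) ∈ Fin m × Fin n encoded in Fin (m * n) via remQuot
_□_ : ∀ {m n} → Graph m → Graph n → Graph (m * n)
_□_ {m} {n} G H = mkGraph λ p q →
  let x = proj₁ (remQuot {m} n p) ; y = proj₂ (remQuot {m} n p)
      x' = proj₁ (remQuot {m} n q) ; y' = proj₂ (remQuot {m} n q)
  in (⌊ x ≟ x' ⌋ ∧ adj H y y') ∨ (⌊ y ≟ y' ⌋ ∧ adj G x x')

_≐_ : ∀ {n} → Graph n → Graph n → Set
G ≐ H = ∀ u v → adj G u v ≡ adj H u v

-- Every vertex (x , y) of G □ H has degree d_G(x) + d_H(y). Hence two vertices of one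
-- H-layer (or of one G-layer) have equal degree in G □ H exactly when they have equal
-- degree in H (resp. G), so on each layer the δ-complement of G □ H agrees with
-- G_δ □ H_δ; if G or H is K₁ the product is a single layer. Conversely, a simple graph
-- on at least two vertices has two distinct vertices of equal degree (pigeonhole: the
-- degrees 0 and n - 1 cannot both occur). Picking such x ≠ x' in G and y ≠ y' in H,
-- the vertices (x , y) and (x' , y') are non-adjacent in G □ H and of equal degree, so
-- adjacent in (G □ H)_δ, whereas in G_δ □ H_δ they are not adjacent.
module Submission where

open import Defs
open import Data.Bool using (Bool; true; false; if_then_else_; _∧_; _∨_; not)
open import Data.Bool.Properties using (T-≡; ∧-zeroʳ; ∧-identityʳ; ∨-identityʳ)
open import Data.Empty using (⊥-elim)
open import Data.Fin using (Fin; zero; suc; combine; remQuot; _↑ˡ_; _↑ʳ_; toℕ; fromℕ<)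
open import Data.Fin.Properties
  using ( _≟_; suc-injective; remQuot-combine; combine-remQuot; combine-injective
        ; pigeonhole; any?; toℕ-fromℕ<; <⇒≢)
open import Data.Nat using (ℕ; zero; suc; pred; _+_; _*_; _≡ᵇ_; _≤_; _<_; z≤n; s≤s; s≤s⁻¹; ≢-nonZero)
import Data.Nat.Properties as ℕ
open import Data.Product using (_×_; _,_; proj₁; proj₂; ∃₂)
open import Data.Sum using (_⊎_; inj₁; inj₂)
open import Function using (_∘_; Equivalence)
open import Function.Bundles using (_⇔_; mk⇔)
open import Relation.Nullary using (¬_; Dec; yes; no; contradiction)
open import Relation.Nullary.Decidable using (⌊_⌋; isYes≗does; dec-true; dec-false; ⌊⌋-map′)
open import Relation.Binary.PropositionalEquality
  using (_≡_; _≢_; _≗_; refl; sym; trans; cong; cong₂; subst₂; module ≡-Reasoning)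

Loopless : ∀ {n} → Graph n → Set
Loopless G = ∀ u → adj G u u ≡ false

indicator : Bool → ℕ
indicator b = if b then 1 else 0

∑ : ∀ {n} → (Fin n → ℕ) → ℕ
∑ {zero}  g = 0
∑ {suc n} g = g zero + ∑ (g ∘ suc)

⌊⌋-true : ∀ {A : Set} (a? : Dec A) → A → ⌊ a? ⌋ ≡ true
⌊⌋-true a? a = trans (isYes≗does a?) (dec-true a? a)

⌊⌋-false : ∀ {A : Set} (a? : Dec A) → ¬ A → ⌊ a? ⌋ ≡ false
⌊⌋-false a? ¬a = trans (isYes≗does a?) (dec-false a? ¬a)

⌊suc≟suc⌋ : ∀ {n} (i j : Fin n) → ⌊ suc i ≟ suc j ⌋ ≡ ⌊ i ≟ j ⌋
⌊suc≟suc⌋ i j = ⌊⌋-map′ (cong suc) suc-injective (i ≟ j)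

⌊combine≟combine⌋ : ∀ {m n} (x x' : Fin m) (y y' : Fin n) →
  ⌊ combine x y ≟ combine x' y' ⌋ ≡ ⌊ x ≟ x' ⌋ ∧ ⌊ y ≟ y' ⌋
⌊combine≟combine⌋ x x' y y' with x ≟ x' | y ≟ y'
... | yes refl | yes refl = ⌊⌋-true (combine x y ≟ combine x y) refl
... | yes refl | no y≢y'  =
  ⌊⌋-false (combine x y ≟ combine x y') (y≢y' ∘ proj₂ ∘ combine-injective x y x y')
... | no x≢x'  | _        =
  ⌊⌋-false (combine x y ≟ combine x' y') (x≢x' ∘ proj₁ ∘ combine-injective x y x' y')

∀-combine : ∀ {m n} (P : Fin (m * n) → Fin (m * n) → Set) →
  (∀ x y x' y' → P (combine x y) (combine x' y')) → ∀ u v → P u v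
∀-combine {m} {n} P h u v = subst₂ P (combine-remQuot {m} n u) (combine-remQuot {m} n v)
  (h (proj₁ (remQuot {m} n u)) (proj₂ (remQuot {m} n u)) (proj₁ (remQuot {m} n v)) (proj₂ (remQuot {m} n v)))

+-cancelˡ-≡ᵇ : ∀ a b c → (a + b ≡ᵇ a + c) ≡ (b ≡ᵇ c)
+-cancelˡ-≡ᵇ zero    b c = refl
+-cancelˡ-≡ᵇ (suc a) b c = +-cancelˡ-≡ᵇ a b c

+-cancelʳ-≡ᵇ : ∀ a b c → (b + a ≡ᵇ c + a) ≡ (b ≡ᵇ c)
+-cancelʳ-≡ᵇ a b c rewrite ℕ.+-comm b a | ℕ.+-comm c a = +-cancelˡ-≡ᵇ a b c

∑-cong : ∀ {n} {f g : Fin n → ℕ} → f ≗ g → ∑ f ≡ ∑ g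
∑-cong {zero}  f≗g = refl
∑-cong {suc n} f≗g = cong₂ _+_ (f≗g zero) (∑-cong (f≗g ∘ suc))

∑-pick : ∀ {n} (x : Fin n) a (g : Fin n → ℕ) → g x ≡ 0 →
  ∑ (λ i → if ⌊ x ≟ i ⌋ then a else g i) ≡ a + ∑ g
∑-pick zero    a g gx≡0 rewrite gx≡0 = refl
∑-pick (suc x) a g gx≡0 = begin
  g zero + ∑ (λ i → if ⌊ suc x ≟ suc i ⌋ then a else g (suc i))
    ≡⟨ cong (g zero +_) (∑-cong λ i → cong (if_then a else g (suc i)) (⌊suc≟suc⌋ x i)) ⟩
  g zero + ∑ (λ i → if ⌊ x ≟ i ⌋ then a else g (suc i))
    ≡⟨ cong (g zero +_) (∑-pick x a (g ∘ suc) gx≡0) ⟩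
  g zero + (a + ∑ (g ∘ suc))
    ≡⟨ ℕ.+-comm (g zero) _ ⟩
  (a + ∑ (g ∘ suc)) + g zero
    ≡⟨ ℕ.+-assoc a _ _ ⟩
  a + (∑ (g ∘ suc) + g zero)
    ≡⟨ cong (a +_) (ℕ.+-comm _ (g zero)) ⟩
  a + ∑ g ∎
  where open ≡-Reasoning

countTrue-cong : ∀ {n} {f g : Fin n → Bool} → f ≗ g → countTrue f ≡ countTrue g
countTrue-cong {zero}  f≗g = refl
countTrue-cong {suc n} f≗g = cong₂ _+_ (cong indicator (f≗g zero)) (countTrue-cong (f≗g ∘ suc))

countTrue≡∑ : ∀ {n} (f : Fin n → Bool) → countTrue f ≡ ∑ (indicator ∘ f)
countTrue≡∑ {zero}  f = refl
countTrue≡∑ {suc n} f = cong (indicator (f zero) +_) (countTrue≡∑ (f ∘ suc))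

countTrue-↑ : ∀ a b (f : Fin (a + b) → Bool) →
  countTrue f ≡ countTrue (f ∘ (_↑ˡ b)) + countTrue (f ∘ (a ↑ʳ_))
countTrue-↑ zero    b f = refl
countTrue-↑ (suc a) b f =
  trans (cong (indicator (f zero) +_) (countTrue-↑ a b (f ∘ suc)))
        (sym (ℕ.+-assoc (indicator (f zero)) _ _))

countTrue-combine : ∀ m n (f : Fin (m * n) → Bool) →
  countTrue f ≡ ∑ {m} (λ i → countTrue {n} (λ j → f (combine i j)))
countTrue-combine zero    n f = refl
countTrue-combine (suc m) n f =
  trans (countTrue-↑ n (m * n) f)
        (cong (countTrue (λ j → f (combine {suc m} zero j)) +_) (countTrue-combine m n (f ∘ (n ↑ʳ_))))

countTrue-single : ∀ {n} (y : Fin n) (b : Bool) → countTrue (λ j → ⌊ y ≟ j ⌋ ∧ b) ≡ indicator b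
countTrue-single {suc n} zero    b = trans (cong (indicator b +_) (countTrue-false n)) (ℕ.+-identityʳ _)
  where
  countTrue-false : ∀ k → countTrue {k} (λ _ → false) ≡ 0
  countTrue-false zero    = refl
  countTrue-false (suc k) = countTrue-false k
countTrue-single {suc n} (suc y) b =
  trans (countTrue-cong λ j → cong (_∧ b) (⌊suc≟suc⌋ y j)) (countTrue-single y b)

countTrue≤ : ∀ {n} (f : Fin n → Bool) → countTrue f ≤ n
countTrue≤ {zero}  f = z≤n
countTrue≤ {suc n} f with f zero
... | true  = s≤s (countTrue≤ (f ∘ suc))
... | false = ℕ.m≤n⇒m≤1+n (countTrue≤ (f ∘ suc))

countTrue< : ∀ {n} (f : Fin n → Bool) u → f u ≡ false → countTrue f < n
countTrue< f zero    fu≡false rewrite fu≡false = s≤s (countTrue≤ (f ∘ suc))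
countTrue< f (suc u) fu≡false with f zero
... | true  = s≤s (countTrue< (f ∘ suc) u fu≡false)
... | false = ℕ.m≤n⇒m≤1+n (countTrue< (f ∘ suc) u fu≡false)

countTrue+2≤ : ∀ {n} (f : Fin n → Bool) u v → u ≢ v → f u ≡ false → f v ≡ false →
  2 + countTrue f ≤ n
countTrue+2≤ f zero    zero    u≢v _ _ = ⊥-elim (u≢v refl)
countTrue+2≤ f zero    (suc v) _ fu≡false fv≡false rewrite fu≡false = s≤s (countTrue< (f ∘ suc) v fv≡false)
countTrue+2≤ f (suc u) zero    _ fu≡false fv≡false rewrite fv≡false = s≤s (countTrue< (f ∘ suc) u fu≡false)
countTrue+2≤ f (suc u) (suc v) u≢v fu≡false fv≡false with f zero
... | true  = s≤s (countTrue+2≤ (f ∘ suc) u v (u≢v ∘ cong suc) fu≡false fv≡false)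
... | false = ℕ.m≤n⇒m≤1+n (countTrue+2≤ (f ∘ suc) u v (u≢v ∘ cong suc) fu≡false fv≡false)

countTrue≡0⇒false : ∀ {n} (f : Fin n → Bool) → countTrue f ≡ 0 → ∀ v → f v ≡ false
countTrue≡0⇒false {suc n} f count≡0 v with f zero in f0
countTrue≡0⇒false {suc n} f ()      v       | true
countTrue≡0⇒false {suc n} f count≡0 zero    | false = f0
countTrue≡0⇒false {suc n} f count≡0 (suc v) | false = countTrue≡0⇒false (f ∘ suc) count≡0 v

pigeonhole-ℕ : ∀ {k} (f : Fin (suc k) → ℕ) → (∀ u → f u < k) → ∃₂ λ u v → u ≢ v × f u ≡ f v
pigeonhole-ℕ {k} f f<k with pigeonhole (ℕ.n<1+n k) (λ u → fromℕ< (f<k u))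
... | u , v , u<v , same = u , v , <⇒≢ u<v ,
  trans (sym (toℕ-fromℕ< (f<k u))) (trans (cong toℕ same) (toℕ-fromℕ< (f<k v)))

degree<order : ∀ {n} (G : Graph (suc n)) → Loopless G → ∀ u → degree G u < suc n
degree<order G loopless u = countTrue< (adj G u) u (loopless u)

degree<order∸1 : ∀ {n} (G : Graph (suc n)) → IsSimple G →
  ∀ z → degree G z ≡ 0 → ∀ u → u ≢ z → degree G u < n
degree<order∸1 G simple z isolated u u≢z =
  s≤s⁻¹ (countTrue+2≤ (adj G u) u z u≢z (IsSimple.irreflexive simple u)
    (trans (IsSimple.symmetric simple u z) (countTrue≡0⇒false (adj G z) isolated u)))

equal-degrees : ∀ {m} (G : Graph (suc (suc m))) → IsSimple G →
  ∃₂ λ x x' → x ≢ x' × degree G x ≡ degree G x'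
equal-degrees {m} G simple with any? (λ z → degree G z ℕ.≟ 0)
... | yes (z , isolated) = pigeonhole-ℕ (degree G) bound
  where
  bound : ∀ u → degree G u < suc m
  bound u with u ≟ z
  ... | yes refl = ℕ.≤-trans (ℕ.≤-reflexive (cong suc isolated)) (s≤s z≤n)
  ... | no u≢z   = degree<order∸1 G simple z isolated u u≢z
... | no none with pigeonhole-ℕ (pred ∘ degree G) bound
  where
  bound : ∀ u → pred (degree G u) < suc m
  bound u = ℕ.pred-mono-< {{≢-nonZero (none ∘ (u ,_))}} (degree<order G (IsSimple.irreflexive simple) u)
...   | x , x' , x≢x' , same =
  x , x' , x≢x' , ℕ.pred-injective {{≢-nonZero (none ∘ (x ,_))}} {{≢-nonZero (none ∘ (x' ,_))}} same

δ-adj : Bool → Bool → Bool → Bool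
δ-adj equal sameDegree a = if equal then false else (if sameDegree then not a else a)

adj-□ : ∀ {m n} (G : Graph m) (H : Graph n) x y x' y' →
  adj (G □ H) (combine x y) (combine x' y') ≡ (⌊ x ≟ x' ⌋ ∧ adj H y y') ∨ (⌊ y ≟ y' ⌋ ∧ adj G x x')
adj-□ {m} {n} G H x y x' y' =
  cong₂ product-adj (remQuot-combine {m} {n} x y) (remQuot-combine {m} {n} x' y')
  where
  product-adj : Fin m × Fin n → Fin m × Fin n → Bool
  product-adj (x , y) (x' , y') = (⌊ x ≟ x' ⌋ ∧ adj H y y') ∨ (⌊ y ≟ y' ⌋ ∧ adj G x x')

adj-□-across : ∀ {m n} (G : Graph m) (H : Graph n) {x x' y y'} → x ≢ x' → y ≢ y' →
  adj (G □ H) (combine x y) (combine x' y') ≡ false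
adj-□-across G H {x} {x'} {y} {y'} x≢x' y≢y'
  rewrite adj-□ G H x y x' y' | ⌊⌋-false (x ≟ x') x≢x' | ⌊⌋-false (y ≟ y') y≢y' = refl

module _ {m n : ℕ} (G : Graph m) (H : Graph n) where

  degree-□ : Loopless G → ∀ (x : Fin m) (y : Fin n) →
    degree (G □ H) (combine x y) ≡ degree G x + degree H y
  degree-□ loopless x y = begin
    degree (G □ H) (combine x y)
      ≡⟨ countTrue-combine m n (adj (G □ H) (combine x y)) ⟩
    ∑ (λ i → countTrue (λ j → adj (G □ H) (combine x y) (combine {m} i j)))
      ≡⟨ ∑-cong row ⟩
    ∑ (λ i → if ⌊ x ≟ i ⌋ then degree H y else indicator (adj G x i))
      ≡⟨ ∑-pick x (degree H y) _ (cong indicator (loopless x)) ⟩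
    degree H y + ∑ (indicator ∘ adj G x)
      ≡⟨ cong (degree H y +_) (sym (countTrue≡∑ (adj G x))) ⟩
    degree H y + degree G x
      ≡⟨ ℕ.+-comm (degree H y) _ ⟩
    degree G x + degree H y ∎
    where
    open ≡-Reasoning
    row : ∀ i → countTrue (λ j → adj (G □ H) (combine x y) (combine {m} i j))
              ≡ (if ⌊ x ≟ i ⌋ then degree H y else indicator (adj G x i))
    row i = trans (countTrue-cong (adj-□ G H x y i)) (row′ (x ≟ i))
      where
      row′ : (x≟i : Dec (x ≡ i)) → countTrue (λ j → (⌊ x≟i ⌋ ∧ adj H y j) ∨ (⌊ y ≟ j ⌋ ∧ adj G x i))
                                  ≡ (if ⌊ x≟i ⌋ then degree H y else indicator (adj G x i))
      row′ (yes refl) rewrite loopless x =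
        countTrue-cong λ j → trans (cong (adj H y j ∨_) (∧-zeroʳ _)) (∨-identityʳ _)
      row′ (no _) = countTrue-single y (adj G x i)

  adj-δ-□ : Loopless G → ∀ (x : Fin m) (y : Fin n) x' y' →
    adj (δ-complement (G □ H)) (combine x y) (combine x' y')
      ≡ δ-adj (⌊ x ≟ x' ⌋ ∧ ⌊ y ≟ y' ⌋) (degree G x + degree H y ≡ᵇ degree G x' + degree H y')
              ((⌊ x ≟ x' ⌋ ∧ adj H y y') ∨ (⌊ y ≟ y' ⌋ ∧ adj G x x'))
  adj-δ-□ loopless x y x' y'
    rewrite ⌊combine≟combine⌋ x x' y y' | degree-□ loopless x y | degree-□ loopless x' y'
          | adj-□ G H x y x' y' = refl

  δ-complement-□-Hlayer : Loopless G → ∀ (x : Fin m) (y y' : Fin n) →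
    adj (δ-complement (G □ H)) (combine x y) (combine x y')
      ≡ adj (δ-complement G □ δ-complement H) (combine x y) (combine x y')
  δ-complement-□-Hlayer loopless x y y'
    rewrite adj-δ-□ loopless x y x y' | adj-□ (δ-complement G) (δ-complement H) x y x y'
          | ⌊⌋-true (x ≟ x) refl | loopless x | +-cancelˡ-≡ᵇ (degree G x) (degree H y) (degree H y')
          | ∧-zeroʳ ⌊ y ≟ y' ⌋ | ∨-identityʳ (adj H y y') = sym (∨-identityʳ _)

  δ-complement-□-Glayer : Loopless G → Loopless H → ∀ (x x' : Fin m) (y : Fin n) →
    adj (δ-complement (G □ H)) (combine x y) (combine x' y)
      ≡ adj (δ-complement G □ δ-complement H) (combine x y) (combine x' y)
  δ-complement-□-Glayer loopless-G loopless-H x x' y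
    rewrite adj-δ-□ loopless-G x y x' y | adj-□ (δ-complement G) (δ-complement H) x y x' y
          | ⌊⌋-true (y ≟ y) refl | loopless-H y | +-cancelʳ-≡ᵇ (degree H y) (degree G x) (degree G x')
          | ∧-zeroʳ ⌊ x ≟ x' ⌋ | ∧-identityʳ ⌊ x ≟ x' ⌋ = refl

  δ-complement-□-across : Loopless G → ∀ {x x' : Fin m} {y y' : Fin n} → x ≢ x' → y ≢ y' →
    degree G x ≡ degree G x' → degree H y ≡ degree H y' →
    adj (δ-complement (G □ H)) (combine x y) (combine x' y') ≡ true
  δ-complement-□-across loopless {x} {x'} {y} {y'} x≢x' y≢y' dx dy
    rewrite adj-δ-□ loopless x y x' y' | ⌊⌋-false (x ≟ x') x≢x' | ⌊⌋-false (y ≟ y') y≢y'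
          | Equivalence.to T-≡ (ℕ.≡⇒≡ᵇ _ _ (cong₂ _+_ dx dy)) = refl

Distributes-δ : ∀ {m n} (G : Graph m) (H : Graph n) → Set
Distributes-δ G H = δ-complement (G □ H) ≐ (δ-complement G □ δ-complement H)

δ-complement-□-K₁ˡ : ∀ {n} (G : Graph 1) (H : Graph n) → Loopless G → Distributes-δ G H
δ-complement-□-K₁ˡ {n} G H loopless =
  ∀-combine {1} {n} _ λ { zero y zero y' → δ-complement-□-Hlayer G H loopless zero y y' }

δ-complement-□-K₁ʳ : ∀ {m} (G : Graph m) (H : Graph 1) → Loopless G → Loopless H → Distributes-δ G H
δ-complement-□-K₁ʳ {m} G H loopless-G loopless-H =
  ∀-combine {m} {1} _ λ { x zero x' zero → δ-complement-□-Glayer G H loopless-G loopless-H x x' zero }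

¬Distributes-δ : ∀ {m n} (G : Graph (suc (suc m))) (H : Graph (suc (suc n))) →
  IsSimple G → IsSimple H → ¬ Distributes-δ G H
¬Distributes-δ G H simple-G simple-H distributes
  with equal-degrees G simple-G | equal-degrees H simple-H
... | x , x' , x≢x' , dx | y , y' , y≢y' , dy = contradiction (begin
  true
    ≡⟨ δ-complement-□-across G H (IsSimple.irreflexive simple-G) x≢x' y≢y' dx dy ⟨
  adj (δ-complement (G □ H)) (combine x y) (combine x' y')
    ≡⟨ distributes (combine x y) (combine x' y') ⟩
  adj (δ-complement G □ δ-complement H) (combine x y) (combine x' y')
    ≡⟨ adj-□-across (δ-complement G) (δ-complement H) x≢x' y≢y' ⟩
  false ∎) λ ()
  where open ≡-Reasoning

mainTheorem5 : ∀ {m n} (G : Graph (suc m)) (H : Graph (suc n)) →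
    IsSimple G → IsSimple H →
    (δ-complement (G □ H) ≐ (δ-complement G □ δ-complement H)) ⇔ (suc m ≡ 1 ⊎ suc n ≡ 1)
mainTheorem5 {zero} G H simple-G _ =
  mk⇔ (λ _ → inj₁ refl) (λ _ → δ-complement-□-K₁ˡ G H (IsSimple.irreflexive simple-G))
mainTheorem5 {suc m} {zero} G H simple-G simple-H =
  mk⇔ (λ _ → inj₂ refl)
      (λ _ → δ-complement-□-K₁ʳ G H (IsSimple.irreflexive simple-G) (IsSimple.irreflexive simple-H))
mainTheorem5 {suc m} {suc n} G H simple-G simple-H =
  mk⇔ (⊥-elim ∘ ¬Distributes-δ G H simple-G simple-H) λ { (inj₁ ()) ; (inj₂ ()) }
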